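{- Let $P$ be a decreasing tableau and $m,m'\in\mathbb{Z}_{>0}$. Let $\Phi(P,m)=(P',(r_1,c_1),\alpha)$ and $\Phi(P',m')=(P'',(r_2,c_2),\alpha')$. Then $m>m'$ if and only if $c_1<c_2$.
   Context: Tableaux use English notation; cell $(i,j)$ is in row $i$, column $j$. A decreasing tableau is a filling of the diagram of a partition by positive integers strictly decreasing from left to right along rows and from top to bottom along columns. $P_{>r}$ denotes the tableau obtained by deleting the first $r$ rows of $P$ (rows renumbered from 1). A value $x$ is $P$-ejectable if $x$ occurs in the first row of $P$ and either $x-1$ does not occur in the first row, or $x-1$ occurs in the first row and $x-1$ is $P_{>1}$-ejectable (nothing is ejectable in the empty tableau). Insertion $\Phi(P,m)=(P',(r,c),\alpha)$: set $P':=P$, $N:=m$, $i:=1$. At iteration $i$, let $R$ be the set of entries of row $i$ of $P$ (empty if no such row), $n_1$ the largest element of $R$ with $n_1\le N$. (T1) If $n_1$ does not exist, append $N$ at the end of row $i$ of $P'$ and output $(P',\text{new cell},1)$. Otherwise replace $n_1$ in row $i$ of $P'$ by $N$, and: (D) if $n_1=N$ and $N-1\in R$, set $N:=N-1$, go to iteration $i+1$; (DR) else if $n_1<N$ and $n_1$ is not $P_{>i}$-ejectable, set $N:=n_1$, go to iteration $i+1$; otherwise let $n_2$ be the entry immediately right of $n_1$ in row $i$ of $P$ ($0$ if none) and $y$ the largest $P_{>i}$-ejectable value with $n_2<y<n_1$: (IR1) if $y$ exists, $N:=y$, go to iteration $i+1$; (IR2) if not and $n_2>0$, $N:=n_2$,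 go to iteration $i+1$; (T2) if not and $n_2=0$, output $(P',\text{the cell of } N \text{ in row } i,0)$. -}

module Defs where

open import Data.Nat using (ℕ; zero; suc; _+_; _∸_; _<_; _≤_; _≤ᵇ_; _<ᵇ_; _≡ᵇ_)
open import Data.Bool using (Bool; true; false; if_then_else_; _∧_; _∨_; not)
open import Data.List using (List; []; _∷_; _++_; length; [_])
open import Data.Maybe using (Maybe; just; nothing)
open import Data.Product using (_×_; _,_)
open import Data.List.Relation.Unary.All using (All)
open import Data.List.Relation.Unary.Linked using (Linked)

-- A tableau is the list of its rows (top to bottom), each row listed left to right.
Tableau : Set
Tableau = List (List ℕ)

data NonEmptyRow : List ℕ → Set where
  nonempty : ∀ {x xs} → NonEmptyRow (x ∷ xs)

data Below : List ℕ → List ℕ → Set where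
  below-[] : ∀ {R} → Below R []
  below-∷  : ∀ {x y R S} → y < x → Below R S → Below (x ∷ R) (y ∷ S)

_>_ : ℕ → ℕ → Set
x > y = y < x

-- Decreasing tableau: rows nonempty, positive entries, rows strictly
-- decreasing left to right, columns strictly decreasing top to bottom,
-- and (via Below) the shape is a partition.
record DecreasingTableau (P : Tableau) : Set where
  field
    rowsNonEmpty : All NonEmptyRow P
    positive     : All (All (0 <_)) P
    rowsDecr     : All (Linked _>_) P
    colsDecr     : Linked Below P

elem : ℕ → List ℕ → Bool
elem x []       = false
elem x (y ∷ ys) = (x ≡ᵇ y) ∨ elem x ys

ejectable : Tableau → ℕ → Bool
ejectable []        x = false
ejectable (R ∷ Rs)  x = elem x R ∧ (not (elem (x ∸ 1) R) ∨ ejectable Rs (x ∸ 1))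

largestLe : ℕ → List ℕ → Maybe ℕ
largestLe N []       = nothing
largestLe N (x ∷ xs) with largestLe N xs
... | nothing = if x ≤ᵇ N then just x else nothing
... | just y  = if x ≤ᵇ N then (if y ≤ᵇ x then just x else just y) else just y

-- 1-based position of the first occurrence of x in a list (0 if absent)
position : ℕ → List ℕ → ℕ
position x []       = 0
position x (y ∷ ys) = if x ≡ᵇ y then 1 else (if elem x ys then suc (position x ys) else 0)

-- entry at 1-based position c (0 if none)
entryAt : ℕ → List ℕ → ℕ
entryAt c       []       = 0
entryAt zero    (y ∷ ys) = 0
entryAt (suc zero) (y ∷ ys) = y
entryAt (suc (suc c)) (y ∷ ys) = entryAt (suc c) ys

replaceAt : ℕ → ℕ → List ℕ → List ℕ
replaceAt c       v []       = []
replaceAt zero    v (y ∷ ys) = y ∷ ys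
replaceAt (suc zero) v (y ∷ ys) = v ∷ ys
replaceAt (suc (suc c)) v (y ∷ ys) = y ∷ replaceAt (suc c) v ys

findDown : (ℕ → Bool) → ℕ → ℕ → Maybe ℕ
findDown p lo zero    = nothing
findDown p lo (suc k) = if (lo <ᵇ k) ∧ p k then just k else findDown p lo k

-- Output of insertion: new tableau, cell (row, column), α
Output : Set
Output = Tableau × (ℕ × ℕ) × ℕ

-- ins Rs N i : process iteration i, where Rs are rows i, i+1, ... of P
-- (equivalently of P', since rows ≥ i are not yet modified).
-- Returns the new rows i, i+1, ..., the output cell and α.
ins : Tableau → ℕ → ℕ → Output
ins [] N i = ([ N ] ∷ [] , (i , 1) , 1)
ins (R ∷ Rs) N i with largestLe N R
... | nothing = ((R ++ [ N ]) ∷ Rs , (i , suc (length R)) , 1)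
... | just n₁ = continue
  where
    c : ℕ
    c = position n₁ R
    R' : List ℕ
    R' = replaceAt c N R
    recur : ℕ → Output
    recur N' with ins Rs N' (suc i)
    ... | (Rs' , cell , α) = (R' ∷ Rs' , cell , α)
    n₂ : ℕ
    n₂ = entryAt (suc c) R
    continue : Output
    continue =
      if (n₁ ≡ᵇ N) ∧ elem (N ∸ 1) R then recur (N ∸ 1)
      else if (n₁ <ᵇ N) ∧ not (ejectable Rs n₁) then recur n₁
      else (case-y (findDown (ejectable Rs) n₂ n₁))
      where
        case-y : Maybe ℕ → Output
        case-y (just y) = recur y
        case-y nothing  = if 0 <ᵇ n₂ then recur n₂
                          else (R' ∷ Rs , (i , c) , 0)

Φ : Tableau → ℕ → Output
Φ P m = ins P m 1

outTableau : Output → Tableau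
outTableau (T , _ , _) = T

outCol : Output → ℕ
outCol (_ , (_ , c) , _) = c

-- Compare the bumping paths of the two insertions row by row. Bumping paths move
-- weakly left, so the first insertion ends at or left of its position in every
-- row it passes. The value m inserted first becomes ejectable, and so does every
-- value it passes on in the rows below. If m' < m, then in each row the second
-- path either ends strictly right of the first one or passes on a strictly
-- smaller value: equality would need rule (DR) to pass on an ejectable value.
-- Hence it ends strictly right of where the first insertion ended. If m ≤ m',
-- the second path splits each row at or left of the first one and passes on a
-- value at least as large, by the maximality in (IR1); it never stops early,
-- because the value passed on by the first path is ejectable below, and so it
-- ends at or left of where the first insertion ended.

module Submission where

open import Defs
open import Data.Bool using (Bool; true; false; T; not; _∧_; if_then_else_)
open import Data.Empty using (⊥-elim)
open import Data.List using (List; []; _∷_; _++_; [_]; length)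
open import Data.List.Properties using (length-++; ++-assoc; ++-identityʳ; ∷-injectiveʳ)
open import Data.List.Membership.Propositional using (_∈_; _∉_)
open import Data.List.Membership.Propositional.Properties using (∈-++⁺ʳ; ∈-++⁻)
open import Data.List.Relation.Unary.All as All using (All; []; _∷_)
import Data.List.Relation.Unary.All.Properties as Allₚ
import Data.List.Relation.Unary.AllPairs.Properties as AllPairsₚ
open import Data.List.Relation.Unary.AllPairs as AllPairs using (AllPairs; []; _∷_)
open import Data.List.Relation.Unary.Any using (here; there)
open import Data.List.Relation.Unary.Linked as Linked using (Linked; []; [-]; _∷_)
open import Data.List.Relation.Unary.Linked.Properties using (Linked⇒AllPairs; AllPairs⇒Linked)
open import Data.Maybe using (Maybe; just; nothing; _<∣>_)
open import Data.Maybe.Properties using (just-injective)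
open import Data.Nat using (ℕ; zero; suc; _∸_; _<_; _≤_; _≤ᵇ_; _<ᵇ_; _≡ᵇ_; z≤n; z<s; s≤s; s≤s⁻¹; _≤?_; _<?_)
open import Data.Nat.Properties
open import Data.List.Membership.DecPropositional _≟_ using (_∈?_)
open import Data.Product using (_×_; _,_; proj₁; proj₂; ∃-syntax)
open import Data.Sum using (_⊎_; inj₁; inj₂)
open import Data.Unit using (tt)
open import Function.Bundles using (_⇔_; mk⇔)
open import Relation.Nullary using (¬_; yes; no; contradiction)
open import Relation.Binary.PropositionalEquality hiding ([_])

T⇒≡true : ∀ {b} → T b → b ≡ true
T⇒≡true {true} _ = refl

≡true⇒T : ∀ {b} → b ≡ true → T b
≡true⇒T refl = tt

¬T⇒≡false : ∀ {b} → ¬ T b → b ≡ false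
¬T⇒≡false {false} _ = refl
¬T⇒≡false {true} ¬t = ⊥-elim (¬t tt)

≤ᵇ≡true : ∀ {m n} → m ≤ n → (m ≤ᵇ n) ≡ true
≤ᵇ≡true m≤n = T⇒≡true (≤⇒≤ᵇ m≤n)

≤ᵇ≡false : ∀ {m n} → n < m → (m ≤ᵇ n) ≡ false
≤ᵇ≡false {m} {n} n<m = ¬T⇒≡false (λ t → <⇒≱ n<m (≤ᵇ⇒≤ m n t))

<ᵇ≡true : ∀ {m n} → m < n → (m <ᵇ n) ≡ true
<ᵇ≡true m<n = T⇒≡true (<⇒<ᵇ m<n)

≡ᵇ≡true : ∀ m → (m ≡ᵇ m) ≡ true
≡ᵇ≡true m = T⇒≡true (≡⇒≡ᵇ m m refl)

≡ᵇ≡false : ∀ {m n} → m ≢ n → (m ≡ᵇ n) ≡ false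
≡ᵇ≡false {m} {n} m≢n = ¬T⇒≡false (λ t → m≢n (≡ᵇ⇒≡ m n t))

∧≡true⁻ : ∀ a {b} → (a ∧ b) ≡ true → a ≡ true × b ≡ true
∧≡true⁻ true b≡true = refl , b≡true

not≡true⇒≡false : ∀ {b} → not b ≡ true → b ≡ false
not≡true⇒≡false {false} _ = refl

m∸1<m : ∀ {m} → 0 < m → m ∸ 1 < m
m∸1<m {suc m} _ = ≤-refl

m∸1<n⇒m≤n : ∀ {m n} → m ∸ 1 < n → m ≤ n
m∸1<n⇒m≤n {zero}  _   = z≤n
m∸1<n⇒m≤n {suc m} m<n = m<n

m<n⇒m≤n∸1 : ∀ {m n} → m < n → m ≤ n ∸ 1
m<n⇒m≤n∸1 {n = suc n} (s≤s m≤n) = m≤n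

elem⇒∈ : ∀ {x} ys → elem x ys ≡ true → x ∈ ys
elem⇒∈ {x} (y ∷ ys) e with x ≡ᵇ y in x≡ᵇy
... | true  = here (≡ᵇ⇒≡ x y (≡true⇒T x≡ᵇy))
... | false = there (elem⇒∈ ys e)

∈⇒elem : ∀ {x ys} → x ∈ ys → elem x ys ≡ true
∈⇒elem {x} (here refl) rewrite ≡ᵇ≡true x = refl
∈⇒elem {x} {y ∷ ys} (there x∈ys) rewrite ∈⇒elem x∈ys with x ≡ᵇ y
... | true  = refl
... | false = refl

∉⇒elem≡false : ∀ {x ys} → x ∉ ys → elem x ys ≡ false
∉⇒elem≡false {x} {ys} x∉ys = ¬T⇒≡false (λ t → x∉ys (elem⇒∈ ys (T⇒≡true t)))

∈-middle : ∀ {x : ℕ} A {B} → x ∈ A ++ x ∷ B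
∈-middle A = ∈-++⁺ʳ A (here refl)

-- Decreasing rows

Decreasing : List ℕ → Set
Decreasing = AllPairs _>_

rowDecreasing : ∀ {R} → Linked _>_ R → Decreasing R
rowDecreasing = Linked⇒AllPairs (λ y<x z<y → <-trans z<y y<x)

AllPairs-++⁻ : ∀ {A : Set} {R : A → A → Set} xs {ys} → AllPairs R (xs ++ ys) →
  AllPairs R xs × AllPairs R ys × All (λ x → All (R x) ys) xs
AllPairs-++⁻ []       Rys            = [] , Rys , []
AllPairs-++⁻ (x ∷ xs) (Rxys ∷ Rxsys) with AllPairs-++⁻ xs Rxsys
... | Rxs , Rys , Rxsys′ = Allₚ.++⁻ˡ xs Rxys ∷ Rxs , Rys , Allₚ.++⁻ʳ xs Rxys ∷ Rxsys′

split-above : ∀ {n B} A → Decreasing (A ++ n ∷ B) → All (n <_) A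
split-above A d = All.map All.head (proj₂ (proj₂ (AllPairs-++⁻ A d)))

split-below : ∀ {n B} A → Decreasing (A ++ n ∷ B) → All (_< n) B
split-below A d = AllPairs.head (proj₁ (proj₂ (AllPairs-++⁻ A d)))

split-suffix : ∀ {n B} A → Decreasing (A ++ n ∷ B) → Decreasing B
split-suffix A d = AllPairs.tail (proj₁ (proj₂ (AllPairs-++⁻ A d)))

++-∷≢[] : ∀ (A : List ℕ) {x B} → A ++ x ∷ B ≢ []
++-∷≢[] []      ()
++-∷≢[] (_ ∷ _) ()

suc-length< : ∀ A {x : ℕ} {B} → suc (length A) < suc (length (A ++ x ∷ B))
suc-length< A = s≤s (subst (length A <_) (sym (length-++ A)) (m<m+n (length A) z<s))

-- The entry right of a split point, 0 if there is none (the paper's n₂).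
head₀ : List ℕ → ℕ
head₀ []      = 0
head₀ (x ∷ _) = x

head₀< : ∀ {n} B → All (_< n) B → 0 < n → head₀ B < n
head₀< []      _         0<n = 0<n
head₀< (b ∷ B) (b<n ∷ _) _   = b<n

head₀≡0 : ∀ B → All (0 <_) B → head₀ B ≡ 0 → B ≡ []
head₀≡0 []      _         _    = refl
head₀≡0 (b ∷ B) (0<b ∷ _) refl = contradiction 0<b (<-irrefl refl)

≤head₀ : ∀ {n} X {Y} → Decreasing (X ++ n ∷ Y) → n ≤ head₀ (X ++ n ∷ Y)
≤head₀ []      _         = ≤-refl
≤head₀ (x ∷ X) (n<x ∷ _) = <⇒≤ (All.lookup n<x (∈-middle X))

-- In a decreasing row, n is the largest entry ≤ N: the entry n₁ that N replaces.
data SplitAt (N : ℕ) : List ℕ → Set where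
  beyond : ∀ {R} → All (N <_) R → SplitAt N R
  at     : ∀ {A n} B → All (N <_) A → n ≤ N → SplitAt N (A ++ n ∷ B)

splitAt : ∀ N R → SplitAt N R
splitAt N []      = beyond []
splitAt N (x ∷ R) with N <? x
... | no  N≮x = at {A = []} R [] (≮⇒≥ N≮x)
... | yes N<x with splitAt N R
...   | beyond N<R      = beyond (N<x ∷ N<R)
...   | at B N<A n≤N    = at {A = x ∷ _} B (N<x ∷ N<A) n≤N

split-position-≤ : ∀ {M s BS Y} X AS → All (M <_) X → X ++ Y ≡ AS ++ s ∷ BS → s ≤ M →
  length X ≤ length AS
split-position-≤ []      AS        _         _  _   = z≤n
split-position-≤ (x ∷ X) []        (M<x ∷ _) refl s≤M = contradiction s≤M (<⇒≱ M<x)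
split-position-≤ (x ∷ X) (a ∷ AS) (_ ∷ M<X) eq s≤M =
  s≤s (split-position-≤ X AS M<X (∷-injectiveʳ eq) s≤M)

replace-all : ∀ {P : ℕ → Set} {n N B} A → All P (A ++ n ∷ B) → P N → All P (A ++ N ∷ B)
replace-all A Pr PN = Allₚ.++⁺ (Allₚ.++⁻ˡ A Pr) (PN ∷ All.tail (Allₚ.++⁻ʳ A Pr))

replace-decreasing : ∀ {n N B} A → Decreasing (A ++ n ∷ B) → All (N <_) A → n ≤ N →
  Decreasing (A ++ N ∷ B)
replace-decreasing []      (n>B ∷ dB) []          n≤N = All.map (λ b<n → <-≤-trans b<n n≤N) n>B ∷ dB
replace-decreasing (a ∷ A) (a>R ∷ dR) (N<a ∷ N<A) n≤N = replace-all A a>R N<a ∷ replace-decreasing A dR N<A n≤N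

exceeds-middle : ∀ {M N B} A → M < N → All (N <_) A → All (M <_) B → All (M <_) (A ++ N ∷ B)
exceeds-middle A M<N N<A M<B = Allₚ.++⁺ (All.map (<-trans M<N) N<A) (M<N ∷ M<B)

largestLe-beyond : ∀ {N} R → All (N <_) R → largestLe N R ≡ nothing
largestLe-beyond []      []          = refl
largestLe-beyond (x ∷ R) (N<x ∷ N<R) rewrite largestLe-beyond R N<R | ≤ᵇ≡false N<x = refl

largestLe-∈ : ∀ {P : ℕ → Set} {N y} xs → All P xs → largestLe N xs ≡ just y → P y
largestLe-∈ {N = N} (x ∷ xs) (Px ∷ Pxs) e with largestLe N xs in e′
... | nothing with x ≤ᵇ N
...   | true with refl ← e = Px
largestLe-∈ {N = N} (x ∷ xs) (Px ∷ Pxs) e | just z with x ≤ᵇ N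
...   | false with refl ← e = largestLe-∈ xs Pxs e′
...   | true with z ≤ᵇ x
...     | true  with refl ← e = Px
...     | false with refl ← e = largestLe-∈ xs Pxs e′

largestLe-head : ∀ {N x} xs → All (_< x) xs → x ≤ N → largestLe N (x ∷ xs) ≡ just x
largestLe-head {N} {x} xs x>xs x≤N with largestLe N xs in e
... | nothing rewrite ≤ᵇ≡true x≤N = refl
... | just y  rewrite ≤ᵇ≡true x≤N | ≤ᵇ≡true (<⇒≤ (largestLe-∈ xs x>xs e)) = refl

largestLe-at : ∀ {N n B} A → Decreasing (A ++ n ∷ B) → All (N <_) A → n ≤ N →
  largestLe N (A ++ n ∷ B) ≡ just n
largestLe-at []      (n>B ∷ _) []          n≤N = largestLe-head _ n>B n≤N
largestLe-at {N} {n} {B} (a ∷ A) (_ ∷ dR) (N<a ∷ N<A) n≤N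
  with largestLe N (A ++ n ∷ B) | largestLe-at A dR N<A n≤N
... | _ | refl rewrite ≤ᵇ≡false N<a = refl

position-at : ∀ {n B} A → All (n <_) A → position n (A ++ n ∷ B) ≡ suc (length A)
position-at {n} []      []          rewrite ≡ᵇ≡true n = refl
position-at {n} {B} (a ∷ A) (n<a ∷ n<A)
  rewrite ≡ᵇ≡false {n} {a} (<⇒≢ n<a) | ∈⇒elem (∈-middle {n} A {B}) | position-at {n} {B} A n<A = refl

replaceAt-at : ∀ {v n B} A → replaceAt (suc (length A)) v (A ++ n ∷ B) ≡ A ++ v ∷ B
replaceAt-at []          = refl
replaceAt-at (a ∷ [])    = refl
replaceAt-at (a ∷ b ∷ A) = cong (a ∷_) (replaceAt-at (b ∷ A))

entryAt-at : ∀ {n B} A → entryAt (suc (suc (length A))) (A ++ n ∷ B) ≡ head₀ B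
entryAt-at {B = []}    []      = refl
entryAt-at {B = _ ∷ _} []      = refl
entryAt-at             (a ∷ A) = entryAt-at A

-- One step of the insertion

findDown-just : ∀ p lo n {y} → findDown p lo n ≡ just y →
  lo < y × y < n × p y ≡ true × (∀ k → lo < k → k < n → p k ≡ true → k ≤ y)
findDown-just p lo (suc n) e with (lo <ᵇ n) ∧ p n in found
... | true  with refl ← e | lo<ᵇn , pn ← ∧≡true⁻ (lo <ᵇ n) found =
  <ᵇ⇒< lo n (≡true⇒T lo<ᵇn) , ≤-refl , pn , λ _ _ k<1+n _ → s≤s⁻¹ k<1+n
... | false with findDown-just p lo n e
...   | lo<y , y<n , py , largest = lo<y , m<n⇒m<1+n y<n , py , largest′
  where
  largest′ : ∀ k → lo < k → k < suc n → p k ≡ true → k ≤ _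
  largest′ k lo<k k<1+n pk with m≤n⇒m<n∨m≡n (s≤s⁻¹ k<1+n)
  ... | inj₁ k<n  = largest k lo<k k<n pk
  ... | inj₂ refl with () ← trans (sym (cong₂ _∧_ (<ᵇ≡true lo<k) pk)) found

findDown-nothing : ∀ p lo n → findDown p lo n ≡ nothing → ∀ k → lo < k → k < n → p k ≡ false
findDown-nothing p lo (suc n) e k lo<k k<1+n with (lo <ᵇ n) ∧ p n in found
... | false with m≤n⇒m<n∨m≡n (s≤s⁻¹ k<1+n)
...   | inj₁ k<n  = findDown-nothing p lo n e k lo<k k<n
...   | inj₂ refl rewrite <ᵇ≡true lo<k = found

-- Rules (D), (DR), (IR1), (IR2), (T2) at the entry n₁ of row R, with right
-- neighbour n₂ and ej the ejectability in the rows below: the value passed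
-- on to the next row, or nothing for (T2).
bump : List ℕ → (ℕ → Bool) → ℕ → ℕ → ℕ → Maybe ℕ
bump R ej N n₁ n₂ =
  if (n₁ ≡ᵇ N) ∧ elem (N ∸ 1) R then just (N ∸ 1)
  else if (n₁ <ᵇ N) ∧ not (ej n₁) then just n₁
  else findDown ej n₂ n₁ <∣> (if 0 <ᵇ n₂ then just n₂ else nothing)

resume : List ℕ → Tableau → ℕ → ℕ → Maybe ℕ → Output
resume R′ Rs i c nothing   = (R′ ∷ Rs , (i , c) , 0)
resume R′ Rs i c (just N′) = (R′ ∷ outTableau (ins Rs N′ (suc i)) , proj₂ (ins Rs N′ (suc i)))

ins-largestLe-just : ∀ R Rs N i {n₁} → largestLe N R ≡ just n₁ →
  ins (R ∷ Rs) N i ≡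
  resume (replaceAt (position n₁ R) N R) Rs i (position n₁ R)
         (bump R (ejectable Rs) N n₁ (entryAt (suc (position n₁ R)) R))
ins-largestLe-just R Rs N i e with largestLe N R | e
... | just n₁ | refl with (n₁ ≡ᵇ N) ∧ elem (N ∸ 1) R
...   | true  = refl
...   | false with (n₁ <ᵇ N) ∧ not (ejectable Rs n₁)
...     | true  = refl
...     | false with findDown (ejectable Rs) (entryAt (suc (position n₁ R)) R) n₁
...       | just y  = refl
...       | nothing with 0 <ᵇ entryAt (suc (position n₁ R)) R
...         | true  = refl
...         | false = refl

ins-beyond : ∀ {N R} Rs i → All (N <_) R →
  ins (R ∷ Rs) N i ≡ ((R ++ [ N ]) ∷ Rs , (i , suc (length R)) , 1)
ins-beyond {N} {R} Rs i N<R rewrite largestLe-beyond R N<R = refl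

record Bumped (ej : ℕ → Bool) (N n₁ n₂ N′ : ℕ) : Set where
  field
    N′<N       : N′ < N
    N′≤n₁      : N′ ≤ n₁
    n₂≤N′      : n₂ ≤ N′
    0<N′       : 0 < N′
    N′≡n₁⇒¬ej  : N′ ≡ n₁ → ej n₁ ≡ false
    ej⇒≤N′     : ∀ k → n₂ < k → k < n₁ → ej k ≡ true → k ≤ N′

module _ {R : List ℕ} {ej : ℕ → Bool} {N n₁ n₂ : ℕ} where

  bump-just : ∀ {N′} → All (0 <_) R → n₁ ≤ N → n₂ < n₁ →
    bump R ej N n₁ n₂ ≡ just N′ → Bumped ej N n₁ n₂ N′
  bump-just R>0 n₁≤N n₂<n₁ e with (n₁ ≡ᵇ N) ∧ elem (N ∸ 1) R in D
  ... | true with refl ← e | n₁≡ᵇN , N∸1∈R ← ∧≡true⁻ (n₁ ≡ᵇ N) D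
    with refl ← ≡ᵇ⇒≡ n₁ N (≡true⇒T n₁≡ᵇN) = record
    { N′<N      = m∸1<m (≤-<-trans z≤n n₂<n₁)
    ; N′≤n₁     = m∸n≤m N 1
    ; n₂≤N′     = m<n⇒m≤n∸1 n₂<n₁
    ; 0<N′      = All.lookup R>0 (elem⇒∈ R N∸1∈R)
    ; N′≡n₁⇒¬ej = λ N∸1≡N → contradiction N∸1≡N (<⇒≢ (m∸1<m (≤-<-trans z≤n n₂<n₁)))
    ; ej⇒≤N′    = λ _ _ k<N _ → m<n⇒m≤n∸1 k<N
    }
  ... | false with (n₁ <ᵇ N) ∧ not (ej n₁) in DR
  ...   | true with refl ← e | n₁<ᵇN , ¬ej ← ∧≡true⁻ (n₁ <ᵇ N) DR = record
    { N′<N      = <ᵇ⇒< n₁ N (≡true⇒T n₁<ᵇN)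
    ; N′≤n₁     = ≤-refl
    ; n₂≤N′     = <⇒≤ n₂<n₁
    ; 0<N′      = ≤-<-trans z≤n n₂<n₁
    ; N′≡n₁⇒¬ej = λ _ → not≡true⇒≡false ¬ej
    ; ej⇒≤N′    = λ _ _ k<n₁ _ → <⇒≤ k<n₁
    }
  ...   | false with findDown ej n₂ n₁ in F
  ...     | just y with refl ← e | n₂<y , y<n₁ , _ , largest ← findDown-just ej n₂ n₁ F = record
    { N′<N      = <-≤-trans y<n₁ n₁≤N
    ; N′≤n₁     = <⇒≤ y<n₁
    ; n₂≤N′     = <⇒≤ n₂<y
    ; 0<N′      = ≤-<-trans z≤n n₂<y
    ; N′≡n₁⇒¬ej = λ y≡n₁ → contradiction y≡n₁ (<⇒≢ y<n₁)
    ; ej⇒≤N′    = largest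
    }
  ...     | nothing with 0 <ᵇ n₂ in 0<ᵇn₂
  ...       | true with refl ← e = record
    { N′<N      = <-≤-trans n₂<n₁ n₁≤N
    ; N′≤n₁     = <⇒≤ n₂<n₁
    ; n₂≤N′     = ≤-refl
    ; 0<N′      = <ᵇ⇒< 0 n₂ (≡true⇒T 0<ᵇn₂)
    ; N′≡n₁⇒¬ej = λ n₂≡n₁ → contradiction n₂≡n₁ (<⇒≢ n₂<n₁)
    ; ej⇒≤N′    = λ k n₂<k k<n₁ ejk →
        contradiction (trans (sym ejk) (findDown-nothing ej n₂ n₁ F k n₂<k k<n₁)) λ ()
    }

  bump-nothing : bump R ej N n₁ n₂ ≡ nothing → n₂ ≡ 0 × (∀ k → 0 < k → k < n₁ → ej k ≡ false)
  bump-nothing e with (n₁ ≡ᵇ N) ∧ elem (N ∸ 1) R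
  ... | false with (n₁ <ᵇ N) ∧ not (ej n₁)
  ...   | false with findDown ej n₂ n₁ in F
  ...     | nothing with 0 <ᵇ n₂ in 0<ᵇn₂
  ...       | false with refl ← n≤0⇒n≡0 {n₂} (≮⇒≥ (λ 0<n₂ → subst T 0<ᵇn₂ (<⇒<ᵇ 0<n₂))) =
    refl , findDown-nothing ej 0 n₁ F

bump-D : ∀ {R ej N n₂} → elem (N ∸ 1) R ≡ true → bump R ej N N n₂ ≡ just (N ∸ 1)
bump-D {N = N} N∸1∈R rewrite ≡ᵇ≡true N | N∸1∈R = refl

-- Inserting N at the split A ++ n₁ ∷ B either ends in this row by (T2), which
-- needs n₂ = 0, i.e. B = []; or it inserts some N′ into the rows below, and by
-- rule (D) N′ = N ∸ 1 whenever N ∸ 1 lies right of the split.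
data Insertion (A : List ℕ) (n₁ : ℕ) (B : List ℕ) (Rs : Tableau) (N i : ℕ) : Output → Set where
  stops : B ≡ [] → (∀ k → 0 < k → k < n₁ → ejectable Rs k ≡ false) →
          Insertion A n₁ B Rs N i ((A ++ N ∷ B) ∷ Rs , (i , suc (length A)) , 0)
  bumps : ∀ N′ → Bumped (ejectable Rs) N n₁ (head₀ B) N′ → (N ∸ 1 ∈ B → N′ ≡ N ∸ 1) →
          Insertion A n₁ B Rs N i
            ((A ++ N ∷ B) ∷ outTableau (ins Rs N′ (suc i)) , proj₂ (ins Rs N′ (suc i)))

insertion : ∀ {A n₁ B N} Rs i → Decreasing (A ++ n₁ ∷ B) → All (0 <_) (A ++ n₁ ∷ B) →
  All (N <_) A → n₁ ≤ N → Insertion A n₁ B Rs N i (ins ((A ++ n₁ ∷ B) ∷ Rs) N i)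
insertion {A} {n₁} {B} {N} Rs i dR R>0 N<A n₁≤N
  rewrite ins-largestLe-just (A ++ n₁ ∷ B) Rs N i (largestLe-at A dR N<A n₁≤N)
        | position-at {n₁} {B} A (All.map (≤-<-trans n₁≤N) N<A)
        | replaceAt-at {N} {n₁} {B} A | entryAt-at {n₁} {B} A
  with bump (A ++ n₁ ∷ B) (ejectable Rs) N n₁ (head₀ B) in e
... | nothing with n₂≡0 , none ← bump-nothing {A ++ n₁ ∷ B} {ejectable Rs} {N} {n₁} {head₀ B} e =
  stops (head₀≡0 B (All.tail (Allₚ.++⁻ʳ A R>0)) n₂≡0) none
... | just N′ = bumps N′ (bump-just R>0 n₁≤N (head₀< B n₁>B 0<n₁) e) rule-D
  where
  n₁>B : All (_< n₁) B
  n₁>B = split-below A dR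
  0<n₁ : 0 < n₁
  0<n₁ = All.lookup R>0 (∈-middle A)
  rule-D : N ∸ 1 ∈ B → N′ ≡ N ∸ 1
  rule-D N∸1∈B with refl ← ≤-antisym n₁≤N (m∸1<n⇒m≤n (All.lookup n₁>B N∸1∈B)) =
    just-injective (trans (sym e)
      (bump-D {A ++ n₁ ∷ B} {ejectable Rs} {N} {head₀ B} (∈⇒elem (∈-++⁺ʳ A (there N∸1∈B)))))

ejectable-∸1∉ : ∀ {x R} Rs → x ∈ R → x ∸ 1 ∉ R → ejectable (R ∷ Rs) x ≡ true
ejectable-∸1∉ {x} {R} Rs x∈R x∸1∉R rewrite ∈⇒elem x∈R | ∉⇒elem≡false x∸1∉R = refl

ejectable-∸1 : ∀ {x R} Rs → x ∈ R → ejectable Rs (x ∸ 1) ≡ true → ejectable (R ∷ Rs) x ≡ true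
ejectable-∸1 {x} {R} Rs x∈R ej rewrite ∈⇒elem x∈R | ej with elem (x ∸ 1) R
... | true  = refl
... | false = refl

∸1∉-insert : ∀ {x B} A → 0 < x → All (x <_) A → x ∸ 1 ∉ B → x ∸ 1 ∉ A ++ x ∷ B
∸1∉-insert {x} A 0<x x<A x∸1∉B x∸1∈ with ∈-++⁻ A x∸1∈
... | inj₁ x∸1∈A         = <⇒≱ (All.lookup x<A x∸1∈A) (m∸n≤m x 1)
... | inj₂ (here x∸1≡x)  = <⇒≢ (m∸1<m 0<x) x∸1≡x
... | inj₂ (there x∸1∈B) = x∸1∉B x∸1∈B

ins-ejectable : ∀ {T} → All (Linked _>_) T → All (All (0 <_)) T → ∀ {x} i → 0 < x →
  ejectable (outTableau (ins T x i)) x ≡ true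
ins-ejectable {[]} _ _ i 0<x = ejectable-∸1∉ [] (here refl) (∸1∉-insert {B = []} [] 0<x [] λ ())
ins-ejectable {R ∷ Rs} (dR ∷ dRs) (R>0 ∷ Rs>0) {x} i 0<x with splitAt x R
... | beyond x<R rewrite ins-beyond {x} {R} Rs i x<R =
  ejectable-∸1∉ Rs (∈-middle R) (∸1∉-insert {B = []} R 0<x x<R λ ())
... | at {A} {n₁} B x<A n₁≤x
  with ins ((A ++ n₁ ∷ B) ∷ Rs) x i | insertion Rs i (rowDecreasing dR) R>0 x<A n₁≤x
...   | _ | stops refl _ = ejectable-∸1∉ Rs (∈-middle A) (∸1∉-insert A 0<x x<A λ ())
...   | _ | bumps N′ b rule-D with x ∸ 1 ∈? B
...     | no  x∸1∉B =
  ejectable-∸1∉ (outTableau (ins Rs N′ (suc i))) (∈-middle A) (∸1∉-insert A 0<x x<A x∸1∉B)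
...     | yes x∸1∈B with refl ← rule-D x∸1∈B =
  ejectable-∸1 (outTableau (ins Rs (x ∸ 1) (suc i))) (∈-middle A)
    (ins-ejectable dRs Rs>0 (suc i) (Bumped.0<N′ b))

-- Decreasing tableaux

below-++ : ∀ {R S} X → Below R S → Below (R ++ X) S
below-++ X below-[]         = below-[]
below-++ X (below-∷ y<x b) = below-∷ y<x (below-++ X b)

below-replace : ∀ {n N B S} A → Below (A ++ n ∷ B) S → n ≤ N → Below (A ++ N ∷ B) S
below-replace []      below-[]        _   = below-[]
below-replace []      (below-∷ y<n b) n≤N = below-∷ (<-≤-trans y<n n≤N) b
below-replace (a ∷ A) below-[]        _   = below-[]
below-replace (a ∷ A) (below-∷ y<a b) n≤N = below-∷ y<a (below-replace A b n≤N)

below-split : ∀ {n B S} A → Below (A ++ n ∷ B) S → length A < length S →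
  ∃[ AS ] ∃[ s ] ∃[ BS ] S ≡ AS ++ s ∷ BS × length AS ≡ length A × s < n × Below B BS
below-split []      (below-∷ s<n b) _ = [] , _ , _ , refl , refl , s<n , b
below-split (a ∷ A) (below-∷ _ b)   (s≤s |A|<|S|) with below-split A b |A|<|S|
... | AS , s , BS , refl , |AS|≡|A| , s<n , b′ = _ ∷ AS , s , BS , refl , cong suc |AS|≡|A| , s<n , b′

below-head₀ : ∀ {B BS} → Below B BS → Decreasing BS → All (_< head₀ B) BS
below-head₀ below-[]        _          = []
below-head₀ (below-∷ y<x _) (x>BS ∷ _) = y<x ∷ All.map (λ z<y → <-trans z<y y<x) x>BS

nonEmpty-middle : ∀ A {x : ℕ} {B} → NonEmptyRow (A ++ x ∷ B)
nonEmpty-middle []      = nonempty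
nonEmpty-middle (_ ∷ _) = nonempty

open DecreasingTableau

firstRow-decreasing : ∀ {R Rs} → DecreasingTableau (R ∷ Rs) → Decreasing R
firstRow-decreasing T = rowDecreasing (All.head (rowsDecr T))

firstRow-positive : ∀ {R Rs} → DecreasingTableau (R ∷ Rs) → All (0 <_) R
firstRow-positive T = All.head (positive T)

lowerRows : ∀ {R Rs} → DecreasingTableau (R ∷ Rs) → DecreasingTableau Rs
lowerRows T = record
  { rowsNonEmpty = All.tail (rowsNonEmpty T)
  ; positive     = All.tail (positive T)
  ; rowsDecr     = All.tail (rowsDecr T)
  ; colsDecr     = Linked.tail (colsDecr T)
  }

withFirstRow : ∀ {R A N B Rs} → DecreasingTableau (R ∷ Rs) →
  Decreasing (A ++ N ∷ B) → All (0 <_) (A ++ N ∷ B) → (∀ {S} → Below R S → Below (A ++ N ∷ B) S) →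
  DecreasingTableau ((A ++ N ∷ B) ∷ Rs)
withFirstRow {A = A} {N} {B} T dR′ R′>0 below = record
  { rowsNonEmpty = nonEmpty-middle A ∷ All.tail (rowsNonEmpty T)
  ; positive     = R′>0 ∷ All.tail (positive T)
  ; rowsDecr     = AllPairs⇒Linked dR′ ∷ All.tail (rowsDecr T)
  ; colsDecr     = cols below (colsDecr T)
  }
  where
  cols : ∀ {R Rs} → (∀ {S} → Below R S → Below (A ++ N ∷ B) S) →
    Linked Below (R ∷ Rs) → Linked Below ((A ++ N ∷ B) ∷ Rs)
  cols _     [-]      = [-]
  cols below (b ∷ bs) = below b ∷ bs

appendEntry : ∀ {R Rs N} → DecreasingTableau (R ∷ Rs) → All (N <_) R → 0 < N →
  DecreasingTableau ((R ++ [ N ]) ∷ Rs)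
appendEntry {R} {N = N} T N<R 0<N = withFirstRow T
  (AllPairsₚ.++⁺ (firstRow-decreasing T) ([] ∷ []) (All.map (_∷ []) N<R))
  (Allₚ.++⁺ (firstRow-positive T) (0<N ∷ []))
  (below-++ [ N ])

replaceEntry : ∀ {A n B Rs N} → DecreasingTableau ((A ++ n ∷ B) ∷ Rs) → All (N <_) A → n ≤ N →
  DecreasingTableau ((A ++ N ∷ B) ∷ Rs)
replaceEntry {A} T N<A n≤N = withFirstRow T
  (replace-decreasing A (firstRow-decreasing T) N<A n≤N)
  (replace-all A (firstRow-positive T) (<-≤-trans (All.lookup (firstRow-positive T) (∈-middle A)) n≤N))
  (λ b → below-replace A b n≤N)

singletonTableau : ∀ {N} → 0 < N → DecreasingTableau ([ N ] ∷ [])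
singletonTableau 0<N = record
  { rowsNonEmpty = nonempty ∷ []
  ; positive     = (0<N ∷ []) ∷ []
  ; rowsDecr     = [-] ∷ []
  ; colsDecr     = [-]
  }

-- Bounds on the column of an insertion

-- Were s > N′, then s ∸ 1 would not occur in its row (entries right of s are
-- below head₀ B ≤ N′), so s would be ejectable, against the maximality of N′.
entryBelow≤bumped : ∀ {AS s BS B Rs N n₁ N′} → Decreasing (AS ++ s ∷ BS) → All (0 <_) (AS ++ s ∷ BS) →
  Below B BS → s < n₁ → Bumped (ejectable ((AS ++ s ∷ BS) ∷ Rs)) N n₁ (head₀ B) N′ → s ≤ N′
entryBelow≤bumped {AS} {s} {BS} {Rs = Rs} {N′ = N′} dS S>0 bBS s<n₁ b with s ≤? N′
... | yes s≤N′ = s≤N′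
... | no  s≰N′ = contradiction (ej⇒≤N′ s (≤-<-trans n₂≤N′ N′<s) s<n₁ ejectable-s) s≰N′
  where
  open Bumped b
  N′<s : N′ < s
  N′<s = ≰⇒> s≰N′
  BS<s∸1 : All (_< s ∸ 1) BS
  BS<s∸1 = All.map (λ y<hd → <-≤-trans y<hd (≤-trans n₂≤N′ (m<n⇒m≤n∸1 N′<s)))
                   (below-head₀ bBS (split-suffix AS dS))
  ejectable-s : ejectable ((AS ++ s ∷ BS) ∷ Rs) s ≡ true
  ejectable-s = ejectable-∸1∉ Rs (∈-middle AS)
    (∸1∉-insert AS (All.lookup S>0 (∈-middle AS)) (split-above AS dS)
      (Allₚ.All¬⇒¬Any (All.map (λ y<s∸1 s∸1≡y → <⇒≢ y<s∸1 (sym s∸1≡y)) BS<s∸1)))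

aboveBumped-prefix≤ : ∀ {A n₁ B S Rs N N′} → DecreasingTableau ((A ++ n₁ ∷ B) ∷ S ∷ Rs) →
  Bumped (ejectable (S ∷ Rs)) N n₁ (head₀ B) N′ →
  ∀ X {Y} → S ≡ X ++ Y → All (N′ <_) X → length X ≤ length A
aboveBumped-prefix≤ {A} {S = S} {Rs} T b X {Y} S≡XY N′<X with length S ≤? length A
... | yes |S|≤|A| = ≤-trans (subst (λ Z → length X ≤ length Z) (sym S≡XY) |X|≤|XY|) |S|≤|A|
  where
  |X|≤|XY| : length X ≤ length (X ++ Y)
  |X|≤|XY| = subst (length X ≤_) (sym (length-++ X)) (m≤m+n _ _)
... | no |S|≰|A| with below-split A (Linked.head (colsDecr T)) (≰⇒> |S|≰|A|)
...   | AS , s , BS , refl , |AS|≡|A| , s<n₁ , bBS =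
  subst (length X ≤_) |AS|≡|A| (split-position-≤ X AS N′<X (sym S≡XY) s≤N′)
  where
  T′ = lowerRows T
  s≤N′ = entryBelow≤bumped {Rs = Rs} (firstRow-decreasing T′) (firstRow-positive T′) bBS s<n₁ b

ins-col≤split : ∀ {A n₁ B Rs N} i → DecreasingTableau ((A ++ n₁ ∷ B) ∷ Rs) → All (N <_) A → n₁ ≤ N →
  outCol (ins ((A ++ n₁ ∷ B) ∷ Rs) N i) ≤ suc (length A)
ins-col≤split {A} {n₁} {B} {[]} {N} i T N<A n₁≤N
  with ins ((A ++ n₁ ∷ B) ∷ []) N i | insertion [] i (firstRow-decreasing T) (firstRow-positive T) N<A n₁≤N
... | _ | stops _ _   = ≤-refl
... | _ | bumps _ _ _ = s≤s z≤n
ins-col≤split {A} {n₁} {B} {S ∷ Rs} {N} i T N<A n₁≤N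
  with ins ((A ++ n₁ ∷ B) ∷ S ∷ Rs) N i
     | insertion (S ∷ Rs) i (firstRow-decreasing T) (firstRow-positive T) N<A n₁≤N
... | _ | stops _ _   = ≤-refl
... | _ | bumps N′ b _ with splitAt N′ S
...   | beyond N′<S rewrite ins-beyond {N′} {S} Rs (suc i) N′<S =
  s≤s (aboveBumped-prefix≤ T b S (sym (++-identityʳ S)) N′<S)
...   | at {X} Y N′<X n≤N′ =
  ≤-trans (ins-col≤split (suc i) (lowerRows T) N′<X n≤N′) (s≤s (aboveBumped-prefix≤ T b X refl N′<X))

ins-col≤entry : ∀ {A x B Rs N} i → DecreasingTableau ((A ++ x ∷ B) ∷ Rs) → x ≤ N →
  outCol (ins ((A ++ x ∷ B) ∷ Rs) N i) ≤ suc (length A)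
ins-col≤entry {A} {x} {B} {Rs} {N} i T x≤N with A ++ x ∷ B in R≡
... | R with splitAt N R
...   | beyond N<R = contradiction x≤N (<⇒≱ (All.lookup N<R (subst (x ∈_) R≡ (∈-middle A))))
...   | at {X} Y N<X n≤N =
  ≤-trans (ins-col≤split i T N<X n≤N) (s≤s (split-position-≤ X A N<X (sym R≡) x≤N))

-- Two successive insertions

-- Only rule (DR) passes n₁ itself on, and it requires n₁ not to be ejectable.
bumped<ejectable : ∀ {ej N n₁ n₂ N′ M} → Bumped ej N n₁ n₂ N′ → n₁ ≤ M → ej M ≡ true → N′ < M
bumped<ejectable {ej} {n₁ = n₁} b n₁≤M ejM with m≤n⇒m<n∨m≡n (≤-trans (Bumped.N′≤n₁ b) n₁≤M)
... | inj₁ N′<M = N′<M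
... | inj₂ refl with refl ← ≤-antisym n₁≤M (Bumped.N′≤n₁ b) =
  contradiction (trans (sym ejM) (Bumped.N′≡n₁⇒¬ej b refl)) λ ()

insert-right-or-bump< : ∀ {A N B Rs N₂ N′} i → Decreasing (A ++ N ∷ B) → All (0 <_) (A ++ N ∷ B) →
  All (N <_) A → N₂ < N → head₀ B ≤ N′ → ejectable Rs N′ ≡ true →
  suc (length A) < outCol (ins ((A ++ N ∷ B) ∷ Rs) N₂ i) ⊎
  ∃[ N₂′ ] N₂′ < N′ × outCol (ins ((A ++ N ∷ B) ∷ Rs) N₂ i) ≡ outCol (ins Rs N₂′ (suc i))
insert-right-or-bump< {A} {N} {B} {Rs} {N₂} i dR R>0 N<A N₂<N hd≤N′ ejN′ with splitAt N₂ B
... | beyond N₂<B rewrite ins-beyond {N₂} {A ++ N ∷ B} Rs i (exceeds-middle A N₂<N N<A N₂<B) =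
  inj₁ (suc-length< A)
... | at {B₁} {n₁′} B₂ N₂<B₁ n₁′≤N₂ rewrite sym (++-assoc A (N ∷ B₁) (n₁′ ∷ B₂))
  with ins (((A ++ N ∷ B₁) ++ n₁′ ∷ B₂) ∷ Rs) N₂ i
     | insertion Rs i dR R>0 (exceeds-middle A N₂<N N<A N₂<B₁) n₁′≤N₂
...   | _ | stops _ _      = inj₁ (suc-length< A)
...   | _ | bumps N₂′ b₂ _ = inj₂ (N₂′ , bumped<ejectable b₂ n₁′≤N′ ejN′ , refl)
  where
  n₁′≤N′ : n₁′ ≤ _
  n₁′≤N′ = ≤-trans (≤head₀ B₁ (split-suffix A (subst Decreasing (++-assoc A (N ∷ B₁) (n₁′ ∷ B₂)) dR)))
                   hd≤N′

-- N₂ splits the row at the new entry N or left of it; stopping there is impossible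
-- since N′ is ejectable below, and otherwise rule (IR1) picks at least N′.
insert-bump≥ : ∀ {A N B Rs N₂ N′} i → Decreasing (A ++ N ∷ B) → All (0 <_) (A ++ N ∷ B) →
  N ≤ N₂ → N′ < N → 0 < N′ → head₀ B ≤ N′ → ejectable Rs N′ ≡ true →
  ∃[ N₂′ ] N′ ≤ N₂′ × outCol (ins ((A ++ N ∷ B) ∷ Rs) N₂ i) ≡ outCol (ins Rs N₂′ (suc i))
insert-bump≥ {A} {N} {B} {Rs} {N₂} {N′} i dR R>0 N≤N₂ N′<N 0<N′ hd≤N′ ejN′ with splitAt N₂ A
... | beyond N₂<A with ins ((A ++ N ∷ B) ∷ Rs) N₂ i | insertion Rs i dR R>0 N₂<A N≤N₂
...   | _ | stops _ none    = contradiction (trans (sym ejN′) (none N′ 0<N′ N′<N)) λ ()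
...   | _ | bumps N₂′ b₂ _ = N₂′ , N′≤N₂′ , refl
  where
  N′≤N₂′ : N′ ≤ N₂′
  N′≤N₂′ with m≤n⇒m<n∨m≡n hd≤N′
  ... | inj₁ hd<N′ = Bumped.ej⇒≤N′ b₂ N′ hd<N′ N′<N ejN′
  ... | inj₂ refl  = Bumped.n₂≤N′ b₂
insert-bump≥ {N = N} {B} {Rs} {N₂} {N′} i dR R>0 N≤N₂ N′<N 0<N′ hd≤N′ ejN′
  | at {A₁} {n₁′} A₂ N₂<A₁ n₁′≤N₂ rewrite ++-assoc A₁ (n₁′ ∷ A₂) (N ∷ B)
  with ins ((A₁ ++ n₁′ ∷ A₂ ++ N ∷ B) ∷ Rs) N₂ i | insertion Rs i dR R>0 N₂<A₁ n₁′≤N₂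
...   | _ | stops A₂NB≡[] _ = contradiction A₂NB≡[] (++-∷≢[] A₂)
...   | _ | bumps N₂′ b₂ _  =
  N₂′ , <⇒≤ (<-≤-trans N′<N (≤-trans (≤head₀ A₂ (split-suffix A₁ dR)) (Bumped.n₂≤N′ b₂))) , refl

ins-col< : ∀ {T} → DecreasingTableau T → ∀ {N N₂} i → 0 < N → N₂ < N →
  outCol (ins T N i) < outCol (ins (outTableau (ins T N i)) N₂ i)
ins-col< {[]} _ {N} {N₂} i _ N₂<N rewrite ins-beyond {N₂} {[ N ]} [] i (N₂<N ∷ []) = s≤s (s≤s z≤n)
ins-col< {R ∷ Rs} T {N} {N₂} i 0<N N₂<N with splitAt N R
... | beyond N<R rewrite ins-beyond {N} {R} Rs i N<R
                       | ins-beyond {N₂} {R ++ [ N ]} Rs i (exceeds-middle R N₂<N N<R []) =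
  suc-length< R
... | at {A} {n₁} B N<A n₁≤N
  with ins ((A ++ n₁ ∷ B) ∷ Rs) N i
     | insertion Rs i (firstRow-decreasing T) (firstRow-positive T) N<A n₁≤N
     | ins-col≤split i T N<A n₁≤N
...   | _ | stops refl _ | _
  rewrite ins-beyond {N₂} {A ++ [ N ]} Rs i (exceeds-middle A N₂<N N<A []) = suc-length< A
...   | _ | bumps N′ b _ | c₁≤
  with insert-right-or-bump< {Rs = outTableau (ins Rs N′ (suc i))} i
         (firstRow-decreasing T′) (firstRow-positive T′) N<A N₂<N (Bumped.n₂≤N′ b)
         (ins-ejectable (rowsDecr (lowerRows T)) (positive (lowerRows T)) (suc i) (Bumped.0<N′ b))
  where T′ = replaceEntry T N<A n₁≤N
...     | inj₁ right = ≤-<-trans c₁≤ right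
...     | inj₂ (N₂′ , N₂′<N′ , c₂≡) rewrite c₂≡ = ins-col< (lowerRows T) (suc i) (Bumped.0<N′ b) N₂′<N′

ins-col≥ : ∀ {T} → DecreasingTableau T → ∀ {N N₂} i → 0 < N → N ≤ N₂ →
  outCol (ins (outTableau (ins T N i)) N₂ i) ≤ outCol (ins T N i)
ins-col≥ {[]} _ i 0<N N≤N₂ = ins-col≤entry {A = []} i (singletonTableau 0<N) N≤N₂
ins-col≥ {R ∷ Rs} T {N} {N₂} i 0<N N≤N₂ with splitAt N R
... | beyond N<R rewrite ins-beyond {N} {R} Rs i N<R = ins-col≤entry i (appendEntry T N<R 0<N) N≤N₂
... | at {A} {n₁} B N<A n₁≤N
  with ins ((A ++ n₁ ∷ B) ∷ Rs) N i | insertion Rs i (firstRow-decreasing T) (firstRow-positive T) N<A n₁≤N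
...   | _ | stops refl _ = ins-col≤entry i (replaceEntry T N<A n₁≤N) N≤N₂
...   | _ | bumps N′ b _
  with insert-bump≥ {Rs = outTableau (ins Rs N′ (suc i))} i
         (firstRow-decreasing T′) (firstRow-positive T′) N≤N₂ (Bumped.N′<N b) (Bumped.0<N′ b) (Bumped.n₂≤N′ b)
         (ins-ejectable (rowsDecr (lowerRows T)) (positive (lowerRows T)) (suc i) (Bumped.0<N′ b))
  where T′ = replaceEntry T N<A n₁≤N
...     | N₂′ , N′≤N₂′ , c₂≡ rewrite c₂≡ = ins-col≥ (lowerRows T) (suc i) (Bumped.0<N′ b) N′≤N₂′

corollary5p9 : (P : Tableau) → DecreasingTableau P → (m m' : ℕ) → 0 < m → 0 < m' →
    (m' < m) ⇔ (outCol (Φ P m) < outCol (Φ (outTableau (Φ P m)) m'))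
corollary5p9 P T m m' 0<m _ = mk⇔ (ins-col< T 1 0<m) col<⇒m'<m
  where
  col<⇒m'<m : outCol (Φ P m) < outCol (Φ (outTableau (Φ P m)) m') → m' < m
  col<⇒m'<m col< with m' <? m
  ... | yes m'<m = m'<m
  ... | no  m'≮m = contradiction (ins-col≥ T 1 0<m (≮⇒≥ m'≮m)) (<⇒≱ col<)
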